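{- The logic of change with postconditions true and false only is equally expressive as the logic with arbitrary postconditions: for every formula $\phi\in\mathcal{L}$ there is a formula $\phi^{TF}\in\mathcal{L}^{TF}$ such that for every epistemic state $(M,s)$, $(M,s)\models\phi$ iff $(M,s)\models\phi^{TF}$.
   Context: Fix a finite set of agents $A$ and a countable set of atoms $P$. Language $\mathcal{L}$: $\phi ::= p \mid \neg\phi \mid \phi\wedge\phi \mid [\alpha]\phi$, $\alpha ::= a \mid G^* \mid (\mathsf{U},\mathsf{e})$ ($G\subseteq A$), defined simultaneously with update models $\mathsf{U}=(\mathsf{E},\mathsf{R},\mathsf{pre},\mathsf{post})$: finite nonempty $\mathsf{E}$, $\mathsf{R}:A\to\wp(\mathsf{E}\times\mathsf{E})$, $\mathsf{pre}:\mathsf{E}\to\mathcal{L}$, $\mathsf{post}:\mathsf{E}\to(P\to\mathcal{L})$ with $\mathsf{post}(\mathsf{e})(p)=p$ for all but finitely many $p$. Semantics on epistemic models $M=(S,R,V)$ ($S\neq\emptyset$, $R:A\to\wp(S\times S)$, $V:P\to\wp(S)$): atoms via $V$; Boolean connectives as usual; $[a]\phi$ true at $s$ iff $\phi$ true at all $R(a)$-successors; $[G^*]\phi$ iff $\phi$ true at all states reachable via the reflexive transitive closure of $\bigcup_{a\in G}R(a)$; $[\mathsf{U},\mathsf{e}]\phi$ true at $(M,s)$ iff $(M,s)\models\mathsf{pre}(\mathsf{e})$ implies $(M\otimes\mathsf{U},(s,\mathsf{e}))\models\phi$, where $M\otimes\mathsf{U}$ has domain $\{(t,\mathsf{f}) :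 (M,t)\models\mathsf{pre}(\mathsf{f})\}$, $((t,\mathsf{f}),(u,\mathsf{g}))\in R^\otimes(a)$ iff $(t,u)\in R(a)$ and $(\mathsf{f},\mathsf{g})\in\mathsf{R}(a)$, and $(t,\mathsf{f})\in V^\otimes(p)$ iff $(M,t)\models\mathsf{post}(\mathsf{f})(p)$. $\mathcal{L}^{TF}$ is the fragment of $\mathcal{L}$ in which every update model occurring (at any depth, including inside pre- and postconditions) has, for every event $\mathsf{e}$ and every $p\in\mathrm{dom}(\mathsf{post}(\mathsf{e}))$, $\mathsf{post}(\mathsf{e})(p)\in\{\top,\bot\}$. -}

module Defs where

open import Data.Nat using (ℕ; suc; _<?_)
open import Data.Fin using (Fin; toℕ; fromℕ<)
open import Data.Fin.Subset using (Subset; _∈_)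
open import Data.Bool using (Bool; T)
open import Data.Product using (Σ; _×_; _,_)
open import Data.Sum using (_⊎_)
open import Relation.Nullary using (yes; no)
open import Relation.Binary.PropositionalEquality using (_≡_)
open import Relation.Binary.Construct.Closure.ReflexiveTransitive using (Star)

mutual
  data Form (nA : ℕ) : Set where
    atom : ℕ → Form nA
    ¬f_  : Form nA → Form nA
    _∧f_ : Form nA → Form nA → Form nA
    box  : Fin nA → Form nA → Form nA
    star : Subset nA → Form nA → Form nA
    upd  : (U : UM nA) → Fin (suc (events U)) → Form nA → Form nA

  -- Postconditions: atoms p < N get post e p; atoms p ≥ N are unchanged
  -- (post(e)(p) = p), which encodes the finite-support requirement.
  data UM (nA : ℕ) : Set where
    um : (k N : ℕ)
         (rel  : Fin nA → Fin (suc k) → Fin (suc k) → Bool)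
         (pre  : Fin (suc k) → Form nA)
         (post : Fin (suc k) → Fin N → Form nA) → UM nA

  -- number of events minus one
  events : ∀ {nA} → UM nA → ℕ
  events (um k _ _ _ _) = k

record Model (nA : ℕ) : Set₁ where
  field
    S : Set
    R : Fin nA → S → S → Set
    V : ℕ → S → Set
open Model public

prod : ∀ {nA} (M : Model nA) (k N : ℕ)
       (rel : Fin nA → Fin (suc k) → Fin (suc k) → Bool)
       (preS : Fin (suc k) → S M → Set)
       (postS : Fin (suc k) → Fin N → S M → Set) → Model nA
prod M k N rel preS postS = record
  { S = Σ (S M × Fin (suc k)) (λ { (t , f) → preS f t })
  ; R = λ { a ((t , f) , _) ((u , g) , _) → R M a t u × T (rel a f g) }
  ; V = λ { p ((t , f) , _) → val p t f }
  }
  where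
  val : ℕ → S M → Fin (suc k) → Set
  val p t f with p <? N
  ... | yes p<N = postS f (fromℕ< p<N) t
  ... | no _    = V M p t

sat : ∀ {nA} (M : Model nA) → S M → Form nA → Set
sat M s (atom p) = V M p s
sat M s (¬f φ) = sat M s φ → Data.Empty.⊥
  where import Data.Empty
sat M s (φ ∧f ψ) = sat M s φ × sat M s ψ
sat M s (box a φ) = ∀ t → R M a s t → sat M t φ
sat M s (star G φ) =
  ∀ t → Star (λ x y → Σ (Fin _) (λ a → (a ∈ G) × R M a x y)) s t → sat M t φ
sat M s (upd (um k N rel pre post) e φ) =
  (h : sat M s (pre e)) →
  sat (prod M k N rel (λ f t → sat M t (pre f)) (λ f i t → sat M t (post f i)))
      ((s , e) , h) φ

⊥f : ∀ {nA} → Form nA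
⊥f = atom 0 ∧f (¬f atom 0)

⊤f : ∀ {nA} → Form nA
⊤f = ¬f ⊥f

-- A postcondition entry for atom p is allowed in L^TF if it is ⊤ or ⊥,
-- or p ∉ dom(post(e)), i.e. the entry is the identity p.
TFpost : ∀ {nA} → ℕ → Form nA → Set
TFpost p ψ = (ψ ≡ ⊤f) ⊎ (ψ ≡ ⊥f) ⊎ (ψ ≡ atom p)

TF : ∀ {nA} → Form nA → Set
TF (atom p) = Data.Unit.⊤
  where import Data.Unit
TF (¬f φ) = TF φ
TF (φ ∧f ψ) = TF φ × TF ψ
TF (box a φ) = TF φ
TF (star G φ) = TF φ
TF (upd (um k N rel pre post) e φ) =
  ((f : Fin (suc k)) → TF (pre f) × ((i : Fin N) → TFpost (toℕ i) (post f i))) × TF φ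

{-# OPTIONS --safe #-}
-- A TF update cannot record the value of an arbitrary postcondition, and constructively one
-- cannot split its events according to the truth values of the postconditions either.  Instead
-- [U, e] is translated into a marked update over fresh atoms which, besides the events of U, has
-- a copy event with precondition ⊤, reachable from every event.  The product is then bisimilar to
-- the current model on the old atoms, so an atom p rebound by U can be evaluated virtually: at
-- the real state for event f it is the translated post(f)(p), which only reads old atoms, selected
-- by a marker atom for f.  Modalities are relativised to real (non-copy) states; copies never step
-- to real states, so a path ending in a real state is real throughout, which handles [G*].
module Submission where

open import Defs
open import Data.Nat using (ℕ; zero; suc; _+_; _∸_; _⊔_; _<_; _≤_; _≡ᵇ_; _<?_; z≤n; s≤s)
open import Data.Nat.Properties
  using (≤-refl; ≤-trans; <-≤-trans; m≤m+n; m<m+n; +-monoʳ-<; +-identityʳ; m+n≮m; m+n∸m≡n;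
         ≡ᵇ⇒≡; ≡⇒≡ᵇ; m≤m⊔n; m≤n⊔m; m≤n⇒m≤n⊔o; m≤n⇒m≤o⊔n)
open import Data.Fin using (Fin; zero; suc; toℕ; fromℕ<)
open import Data.Fin.Properties using (toℕ-fromℕ<; toℕ-injective; toℕ<n; ∀-cons-⇔)
open import Data.Fin.Subset using (Subset; _∈_)
open import Data.Bool using (Bool; true; false; T)
open import Data.Product using (Σ; ∃-syntax; _×_; _,_; proj₁)
open import Data.Product.Function.NonDependent.Propositional using (_×-⇔_)
open import Data.Sum using (_⊎_; inj₁; inj₂)
import Data.Sum as Sum
open import Data.Empty using (⊥-elim)
open import Data.Unit using (⊤; tt)
open import Function using (flip; _∘_)
open import Function.Bundles using (_⇔_; mk⇔; Equivalence)
open import Function.Related.TypeIsomorphisms using (¬-cong-⇔)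
import Function.Properties.Equivalence as ⇔
open import Function.Related.Propositional using (module EquationalReasoning)
open import Relation.Nullary using (¬_; yes; no)
open import Relation.Binary.PropositionalEquality using (_≡_; refl; sym; cong; subst)
open import Relation.Binary.Construct.Closure.ReflexiveTransitive using (Star; ε; _◅_)

open Equivalence using (to; from)
open EquationalReasoning

private
  variable
    nA : ℕ
    X Y : Set

Π-⇔ : {A B : Set} {F : A → Set} {G : B → Set} →
      A ⇔ B → (∀ a b → F a ⇔ G b) → ((a : A) → F a) ⇔ ((b : B) → G b)
Π-⇔ A⇔B F⇔G = mk⇔ (λ f b → to (F⇔G _ b) (f (from A⇔B b)))
                  (λ g a → from (F⇔G a _) (g (to A⇔B a)))

≡⇒⇔ : {A B : Set} → A ≡ B → A ⇔ B
≡⇒⇔ refl = ⇔.refl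

Forth : (X → Y → Set) → (X → X → Set) → (Y → Y → Set) → Set
Forth {X} {Y} Z RX RY = ∀ {x y x₁} → Z x y → RX x x₁ → ∃[ y₁ ] RY y y₁ × Z x₁ y₁

Forth-Star : {Z : X → Y → Set} {RX : X → X → Set} {RY : Y → Y → Set} →
             Forth Z RX RY → Forth Z (Star RX) (Star RY)
Forth-Star fo z ε = _ , ε , z
Forth-Star fo z (r ◅ p) =
  let (_ , r′ , z′) = fo z r ; (y₁ , p′ , z₁) = Forth-Star fo z′ p in y₁ , r′ ◅ p′ , z₁

Via : ∀ {n} → Subset n → (Fin n → X → X → Set) → X → X → Set
Via G Rs x y = ∃[ a ] a ∈ G × Rs a x y

Forth-Via : ∀ {n} {G : Subset n} {Z : X → Y → Set}
              {RX : Fin n → X → X → Set} {RY : Fin n → Y → Y → Set} →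
            (∀ a → Forth Z (RX a) (RY a)) → Forth Z (Via G RX) (Via G RY)
Forth-Via fo z (a , a∈G , r) = let (y₁ , r′ , z₁) = fo a z r in y₁ , (a , a∈G , r′) , z₁

Guarded : (Y → Y → Set) → (Y → Set) → Y → Y → Set
Guarded RY Q y y₁ = RY y y₁ × Q y₁

Star-Guarded : {RY : Y → Y → Set} {Q : Y → Set} → (∀ {y y₁} → RY y y₁ → Q y₁ → Q y) →
               ∀ {y y₁} → Star RY y y₁ → Q y₁ → Star (Guarded RY Q) y y₁ × Q y
Star-Guarded closed ε q = ε , q
Star-Guarded closed (r ◅ p) q =
  let (p′ , q′) = Star-Guarded closed p q in (r , q′) ◅ p′ , closed r q′

□-cong : {Z : X → Y → Set} {RX : X → X → Set} {RY : Y → Y → Set} {A : X → Set} {B : Y → Set} →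
         Forth Z RX RY → Forth (flip Z) RY RX → (∀ {x y} → Z x y → A x ⇔ B y) →
         ∀ {x y} → Z x y → (∀ x₁ → RX x x₁ → A x₁) ⇔ (∀ y₁ → RY y y₁ → B y₁)
□-cong forth back A⇔B z = mk⇔
  (λ H y₁ r → let (x₁ , r′ , z₁) = back z r in to (A⇔B z₁) (H x₁ r′))
  (λ H x₁ r → let (y₁ , r′ , z₁) = forth z r in from (A⇔B z₁) (H y₁ r′))

-- An update with N postconditions rebinds the atoms below N.
Reads : (ℕ → Set) → Form nA → Set
Reads A (atom p) = A p
Reads A (¬f φ) = Reads A φ
Reads A (φ ∧f ψ) = Reads A φ × Reads A ψ
Reads A (box a φ) = Reads A φ
Reads A (star G φ) = Reads A φ
Reads A (upd (um k N rel pre post) e φ) =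
  (∀ f → Reads A (pre f)) × (∀ f i → Reads A (post f i)) × Reads (λ q → q < N ⊎ A q) φ

Reads-mono : {A A′ : ℕ → Set} → (∀ {q} → A q → A′ q) →
             (φ : Form nA) → Reads A φ → Reads A′ φ
Reads-mono A⊆A′ (atom p) r = A⊆A′ r
Reads-mono A⊆A′ (¬f φ) r = Reads-mono A⊆A′ φ r
Reads-mono A⊆A′ (φ ∧f ψ) (r , r′) = Reads-mono A⊆A′ φ r , Reads-mono A⊆A′ ψ r′
Reads-mono A⊆A′ (box a φ) r = Reads-mono A⊆A′ φ r
Reads-mono A⊆A′ (star G φ) r = Reads-mono A⊆A′ φ r
Reads-mono A⊆A′ (upd (um k N rel pre post) e φ) (r-pre , r-post , r) =
  (λ f → Reads-mono A⊆A′ (pre f) (r-pre f)) , (λ f i → Reads-mono A⊆A′ (post f i) (r-post f i)) ,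
  Reads-mono (Sum.map₂ A⊆A′) φ r

Reads-all : {A : ℕ → Set} → (∀ q → A q) → (φ : Form nA) → Reads A φ
Reads-all all (atom p) = all p
Reads-all all (¬f φ) = Reads-all all φ
Reads-all all (φ ∧f ψ) = Reads-all all φ , Reads-all all ψ
Reads-all all (box a φ) = Reads-all all φ
Reads-all all (star G φ) = Reads-all all φ
Reads-all all (upd (um k N rel pre post) e φ) =
  (λ f → Reads-all all (pre f)) , (λ f i → Reads-all all (post f i)) , Reads-all (λ q → inj₂ (all q)) φ

record Bisim (A : ℕ → Set) (M₁ M₂ : Model nA) : Set₁ where
  field
    Z      : S M₁ → S M₂ → Set
    atom-⇔ : ∀ {q x y} → A q → Z x y → V M₁ q x ⇔ V M₂ q y
    forth  : ∀ a → Forth Z (R M₁ a) (R M₂ a)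
    back   : ∀ a → Forth (flip Z) (R M₂ a) (R M₁ a)

module _ {A : ℕ → Set} {M₁ M₂ : Model nA} (B : Bisim A M₁ M₂) {k N : ℕ}
         {rel : Fin nA → Fin (suc k) → Fin (suc k) → Bool}
         {pre₁ : Fin (suc k) → S M₁ → Set} {pre₂ : Fin (suc k) → S M₂ → Set}
         {post₁ : Fin (suc k) → Fin N → S M₁ → Set} {post₂ : Fin (suc k) → Fin N → S M₂ → Set}
         (pre-⇔ : ∀ f {x y} → Bisim.Z B x y → pre₁ f x ⇔ pre₂ f y)
         (post-⇔ : ∀ f i {x y} → Bisim.Z B x y → post₁ f i x ⇔ post₂ f i y)
         where
  open Bisim B
  private
    P₁ = prod M₁ k N rel pre₁ post₁
    P₂ = prod M₂ k N rel pre₂ post₂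

  prod-bisim : Bisim (λ q → q < N ⊎ A q) P₁ P₂
  prod-bisim = record
    { Z = Z′ ; atom-⇔ = λ {q} {x} {y} → atom-⇔′ {q} {x} {y} ; forth = forth′ ; back = back′ }
    where
    Z′ : S P₁ → S P₂ → Set
    Z′ ((x , f) , _) ((y , g) , _) = Z x y × f ≡ g

    atom-⇔′ : ∀ {q x y} → q < N ⊎ A q → Z′ x y → V P₁ q x ⇔ V P₂ q y
    atom-⇔′ {q} {(_ , f) , _} q∈ (z , refl) with q <? N | q∈
    ... | yes q<N | _ = post-⇔ f (fromℕ< q<N) z
    ... | no q≮N | inj₁ q<N = ⊥-elim (q≮N q<N)
    ... | no _ | inj₂ Aq = atom-⇔ Aq z

    forth′ : ∀ a → Forth Z′ (R P₁ a) (R P₂ a)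
    forth′ a {x₁ = (_ , f₁) , h₁} (z , refl) (r , t) =
      let (y₁ , r′ , z₁) = forth a z r
      in ((y₁ , f₁) , to (pre-⇔ f₁ z₁) h₁) , (r′ , t) , z₁ , refl

    back′ : ∀ a → Forth (flip Z′) (R P₂ a) (R P₁ a)
    back′ a {x₁ = (_ , f₁) , h₁} (z , refl) (r , t) =
      let (x₁ , r′ , z₁) = back a z r
      in ((x₁ , f₁) , from (pre-⇔ f₁ z₁) h₁) , (r′ , t) , z₁ , refl

_⊗_ : Model nA → UM nA → Model nA
M ⊗ um k N rel pre post = prod M k N rel (λ f t → sat M t (pre f)) (λ f i t → sat M t (post f i))

sat-bisim : {A : ℕ → Set} {M₁ M₂ : Model nA} (B : Bisim A M₁ M₂) (φ : Form nA) → Reads A φ →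
            ∀ {x y} → Bisim.Z B x y → sat M₁ x φ ⇔ sat M₂ y φ
sat-bisim B (atom p) r z = Bisim.atom-⇔ B r z
sat-bisim B (¬f φ) r z = ¬-cong-⇔ (sat-bisim B φ r z)
sat-bisim B (φ ∧f ψ) (r , r′) z = sat-bisim B φ r z ×-⇔ sat-bisim B ψ r′ z
sat-bisim B (box a φ) r z = □-cong (Bisim.forth B a) (Bisim.back B a) (sat-bisim B φ r) z
sat-bisim B (star G φ) r z =
  □-cong (Forth-Star (Forth-Via (Bisim.forth B))) (Forth-Star (Forth-Via (Bisim.back B))) (sat-bisim B φ r) z
sat-bisim B (upd (um k N rel pre post) e φ) (r-pre , r-post , r) z =
  Π-⇔ (sat-bisim B (pre e) (r-pre e) z) (λ _ _ → sat-bisim B⊗U φ r (z , refl))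
  where
  B⊗U = prod-bisim B (λ f → sat-bisim B (pre f) (r-pre f)) (λ f i → sat-bisim B (post f i) (r-post f i))

⊤f-holds : (M : Model nA) (x : S M) → sat M x ⊤f
⊤f-holds M x (p , ¬p) = ¬p p

module _ (M : Model nA) {k N : ℕ} (rel : Fin nA → Fin (suc k) → Fin (suc k) → Bool)
         (pre : Fin (suc k) → Form nA) (post : Fin (suc k) → Fin N → Form nA) where

  ⊗-V-unchanged : ∀ {q s} → ¬ q < N → V (M ⊗ um k N rel pre post) q s ⇔ V M q (proj₁ (proj₁ s))
  ⊗-V-unchanged {q} q≮N with q <? N
  ... | yes q<N = ⊥-elim (q≮N q<N)
  ... | no _ = ⇔.refl

  copy-bisim : (A : ℕ → Set) (c : Fin (suc k)) →
               (∀ t → sat M t (pre c)) → (∀ a f → T (rel a f c)) →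
               (∀ {q s} → A q → V (M ⊗ um k N rel pre post) q s ⇔ V M q (proj₁ (proj₁ s))) →
               Bisim A (M ⊗ um k N rel pre post) M
  copy-bisim A c pre-c rel-c kept = record
    { Z = λ s t → proj₁ (proj₁ s) ≡ t
    ; atom-⇔ = λ { {q} {s} Aq refl → kept {q} {s} Aq }
    ; forth = λ { a refl (r , _) → _ , r , refl }
    ; back = λ { a {y = (_ , f) , _} refl r → ((_ , c) , pre-c _) , (r , rel-c a f) , refl }
    }

impRel : Fin nA → Fin 2 → Fin 2 → Bool
impRel _ _ zero = false
impRel _ _ (suc _) = true

impPre : Form nA → Fin 2 → Form nA
impPre α zero = α
impPre α (suc _) = ⊤f

noPost : Fin 2 → Fin 0 → Form nA
noPost _ ()

-- Constructively ¬f (α ∧f ¬f θ) only expresses α → ¬ ¬ θ.  Here event 0 tests α and event 1,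
-- reachable from both, reproduces the whole model.
infixr 4 _⇒f_
_⇒f_ : Form nA → Form nA → Form nA
α ⇒f θ = upd (um 1 0 impRel (impPre α) noPost) zero θ

sat-⇒f : {P : Model nA} {y : S P} (α θ : Form nA) → sat P y (α ⇒f θ) ⇔ (sat P y α → sat P y θ)
sat-⇒f {P = P} α θ = Π-⇔ ⇔.refl λ _ _ → sat-bisim B θ (Reads-all (λ _ → tt) θ) refl
  where
  B : Bisim (λ _ → ⊤) (P ⊗ um 1 0 impRel (impPre α) noPost) P
  B = copy-bisim P impRel (impPre α) noPost (λ _ → ⊤) (suc zero) (⊤f-holds P) (λ _ _ → tt)
                 (λ {q} {s} _ → ⊗-V-unchanged P impRel (impPre α) noPost {q} {s} λ ())

⋀ : ∀ k → (Fin (suc k) → Form nA) → Form nA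
⋀ zero F = F zero
⋀ (suc k) F = F zero ∧f ⋀ k (F ∘ suc)

sat-⋀ : {M : Model nA} {x : S M} (k : ℕ) (F : Fin (suc k) → Form nA) →
        sat M x (⋀ k F) ⇔ (∀ u → sat M x (F u))
sat-⋀ zero F = mk⇔ (λ h → λ { zero → h }) (λ H → H zero)
sat-⋀ (suc k) F = ⇔.trans (⇔.refl ×-⇔ sat-⋀ k (F ∘ suc)) ∀-cons-⇔

sat-select : {M : Model nA} {x : S M} (k : ℕ) (m : Fin (suc k) → ℕ) (θ : Fin (suc k) → Form nA)
             {f : Fin (suc k)} → (∀ u → V M (m u) x ⇔ (u ≡ f)) →
             sat M x (⋀ k (λ u → atom (m u) ⇒f θ u)) ⇔ sat M x (θ f)
sat-select {M = M} {x} k m θ {f} marks = ⇔.trans (sat-⋀ k _) (mk⇔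
  (λ H → to (sat-⇒f (atom (m f)) (θ f)) (H f) (from (marks f) refl))
  (λ θf u → from (sat-⇒f (atom (m u)) (θ u))
                  λ mu → subst (λ g → sat M x (θ g)) (sym (to (marks u) mu)) θf))

truth : Bool → Form nA
truth true = ⊤f
truth false = ⊥f

sat-truth : {M : Model nA} {x : S M} (b : Bool) → sat M x (truth b) ⇔ T b
sat-truth {M = M} {x} true = mk⇔ (λ _ → tt) (λ _ → ⊤f-holds M x)
sat-truth false = mk⇔ (λ (p , ¬p) → ¬p p) λ ()

-- The marked update with first fresh atom L: event zero copies the current model and is reachable
-- from every event, event suc f is event f of the source update.  Atoms below L are kept, and
-- atom L + j gets the value freshMark ev j: atom L marks the real states, atom L + 1 + u event u.
markedRel : ∀ {k} → (Fin nA → Fin (suc k) → Fin (suc k) → Bool) →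
            Fin nA → Fin (suc (suc k)) → Fin (suc (suc k)) → Bool
markedRel rel a _ zero = true
markedRel rel a zero (suc _) = false
markedRel rel a (suc f) (suc g) = rel a f g

markedPre : ∀ {k} → (Fin (suc k) → Form nA) → Fin (suc (suc k)) → Form nA
markedPre pre zero = ⊤f
markedPre pre (suc f) = pre f

freshMark : ∀ {k} → Fin (suc (suc k)) → ℕ → Bool
freshMark zero _ = false
freshMark (suc f) zero = true
freshMark (suc f) (suc m) = m ≡ᵇ toℕ f

markedPost : ∀ {k} → ℕ → Fin (suc (suc k)) → ℕ → Form nA
markedPost L ev q with q <? L
... | yes _ = atom q
... | no _ = truth (freshMark ev (q ∸ L))

marked : ℕ → (k : ℕ) → (Fin nA → Fin (suc k) → Fin (suc k) → Bool) → (Fin (suc k) → Form nA) →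
         UM nA
marked L k rel pre =
  um (suc k) (L + (2 + k)) (markedRel rel) (markedPre pre) (λ ev i → markedPost L ev (toℕ i))

markedPost-low : ∀ {k q} L (ev : Fin (suc (suc k))) → q < L → markedPost {nA} L ev q ≡ atom q
markedPost-low {q = q} L ev q<L with q <? L
... | yes _ = refl
... | no q≮L = ⊥-elim (q≮L q<L)

markedPost-mark : ∀ {k} L (ev : Fin (suc (suc k))) j → markedPost {nA} L ev (L + j) ≡ truth (freshMark ev j)
markedPost-mark L ev j with L + j <? L
... | yes L+j<L = ⊥-elim (m+n≮m L j L+j<L)
... | no _ = cong (truth ∘ freshMark ev) (m+n∸m≡n L j)

module Marked (P : Model nA) (L k : ℕ) (rel : Fin nA → Fin (suc k) → Fin (suc k) → Bool)
              (pre : Fin (suc k) → Form nA) where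

  P⁺ : Model nA
  P⁺ = P ⊗ marked L k rel pre

  marked-V : ∀ {q} y ev h → q < L + (2 + k) → V P⁺ q ((y , ev) , h) ⇔ sat P y (markedPost L ev q)
  marked-V {q} _ _ _ q< with q <? L + (2 + k)
  ... | yes q<′ rewrite toℕ-fromℕ< q<′ = ⇔.refl
  ... | no q≮ = ⊥-elim (q≮ q<)

  low-V : ∀ {q} (s : S P⁺) → q < L → V P⁺ q s ⇔ V P q (proj₁ (proj₁ s))
  low-V ((y , ev) , h) q<L =
    ⇔.trans (marked-V y ev h (<-≤-trans q<L (m≤m+n L _)))
            (≡⇒⇔ (cong (sat P y) (markedPost-low L ev q<L)))

  mark-V : ∀ {j} y ev h → j < 2 + k → V P⁺ (L + j) ((y , ev) , h) ⇔ T (freshMark ev j)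
  mark-V {j} y ev h j< = ⇔.trans (marked-V y ev h (+-monoʳ-< L j<))
                                 (⇔.trans (≡⇒⇔ (cong (sat P y) (markedPost-mark L ev j))) (sat-truth _))

  real-V : ∀ y ev h → V P⁺ L ((y , ev) , h) ⇔ T (freshMark ev 0)
  real-V y ev h =
    subst (λ q → V P⁺ q ((y , ev) , h) ⇔ T (freshMark ev 0)) (+-identityʳ L) (mark-V y ev h (s≤s z≤n))

  event-V : ∀ y f h (u : Fin (suc k)) → V P⁺ (L + suc (toℕ u)) ((y , suc f) , h) ⇔ (u ≡ f)
  event-V y f h u =
    ⇔.trans (mark-V y (suc f) h (s≤s (toℕ<n u)))
            (mk⇔ (λ t → toℕ-injective (≡ᵇ⇒≡ _ _ t)) λ { refl → ≡⇒≡ᵇ (toℕ u) (toℕ u) refl })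

  marked-bisim : Bisim (_< L) P⁺ P
  marked-bisim =
    copy-bisim P {N = L + (2 + k)} (markedRel rel) (markedPre pre) (λ ev i → markedPost L ev (toℕ i))
               (_< L) zero (⊤f-holds P) (λ _ _ → tt) (λ {_} {s} → low-V s)

  sat-marked : ∀ {s} (φ : Form nA) → Reads (_< L) φ → sat P⁺ s φ ⇔ sat P (proj₁ (proj₁ s)) φ
  sat-marked φ r = sat-bisim marked-bisim φ r refl

-- The translation state after a sequence of updates: atoms from fresh on are unused, real holds
-- exactly at the non-copy states, and val p computes the current value of the source atom p.
record Env (nA : ℕ) : Set where
  field
    fresh : ℕ
    real  : Form nA
    val   : ℕ → Form nA
open Env

initial : ℕ → Env nA
initial B = record { fresh = B ; real = ⊤f ; val = atom }

-- The valuation of prod, on formulas.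
valAfter : ∀ {N} → (Fin N → Form nA) → (ℕ → Form nA) → ℕ → Form nA
valAfter {N = N} post val p with p <? N
... | yes p<N = post (fromℕ< p<N)
... | no _ = val p

extend : Env nA → (k N : ℕ) → (Fin (suc k) → Fin N → Form nA) → Env nA
extend E k N post = record
  { fresh = fresh E + (2 + k)
  ; real = real E ∧f atom (fresh E)
  ; val = λ p → ⋀ k (λ u → atom (fresh E + suc (toℕ u)) ⇒f valAfter (post u) (val E) p)
  }

tr : Env nA → Form nA → Form nA
tr E (atom p) = val E p
tr E (¬f φ) = ¬f tr E φ
tr E (φ ∧f ψ) = tr E φ ∧f tr E ψ
tr E (box a φ) = box a (real E ⇒f tr E φ)
tr E (star G φ) = star G (real E ⇒f tr E φ)
tr E (upd (um k N rel pre post) e φ) =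
  upd (marked (fresh E) k rel (λ f → tr E (pre f))) (suc e)
      (tr (extend E k N (λ f i → tr E (post f i))) φ)

⇒f-TF : (α θ : Form nA) → TF α → TF θ → TF (α ⇒f θ)
⇒f-TF α θ tα tθ = (λ { zero → tα , λ () ; (suc _) → (tt , tt) , λ () }) , tθ

⋀-TF : ∀ k (F : Fin (suc k) → Form nA) → (∀ u → TF (F u)) → TF (⋀ k F)
⋀-TF zero F t = t zero
⋀-TF (suc k) F t = t zero , ⋀-TF k (F ∘ suc) (t ∘ suc)

truth-TFpost : ∀ q b → TFpost {nA} q (truth b)
truth-TFpost q true = inj₁ refl
truth-TFpost q false = inj₂ (inj₁ refl)

markedPost-TFpost : ∀ {k} L (ev : Fin (suc (suc k))) q → TFpost {nA} q (markedPost L ev q)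
markedPost-TFpost L ev q with q <? L
... | yes _ = inj₂ (inj₂ refl)
... | no _ = truth-TFpost q _

valAfter-TF : ∀ {N} (post : Fin N → Form nA) (val : ℕ → Form nA) p →
              (∀ i → TF (post i)) → (∀ p → TF (val p)) → TF (valAfter post val p)
valAfter-TF {N = N} post val p t-post t-val with p <? N
... | yes p<N = t-post (fromℕ< p<N)
... | no _ = t-val p

record TFEnv (E : Env nA) : Set where
  field
    real-TF : TF (real E)
    val-TF  : ∀ p → TF (val E p)
open TFEnv

initial-TF : ∀ B → TFEnv {nA} (initial B)
initial-TF B = record { real-TF = (tt , tt) ; val-TF = λ _ → tt }

extend-TF : ∀ {E : Env nA} {k N} {post : Fin (suc k) → Fin N → Form nA} →
            TFEnv E → (∀ f i → TF (post f i)) → TFEnv (extend E k N post)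
extend-TF {E = E} {k} {post = post} tE t-post = record
  { real-TF = real-TF tE , tt
  ; val-TF = λ p → ⋀-TF k _ λ u →
      ⇒f-TF (atom _) (valAfter (post u) (val E) p) tt (valAfter-TF (post u) (val E) p (t-post u) (val-TF tE))
  }

tr-TF : {E : Env nA} → TFEnv E → (φ : Form nA) → TF (tr E φ)
tr-TF tE (atom p) = val-TF tE p
tr-TF tE (¬f φ) = tr-TF tE φ
tr-TF tE (φ ∧f ψ) = tr-TF tE φ , tr-TF tE ψ
tr-TF {E = E} tE (box a φ) = ⇒f-TF (real E) (tr E φ) (real-TF tE) (tr-TF tE φ)
tr-TF {E = E} tE (star G φ) = ⇒f-TF (real E) (tr E φ) (real-TF tE) (tr-TF tE φ)
tr-TF {E = E} tE (upd (um k N rel pre post) e φ) =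
  (λ ev → pre-TF ev , λ i → markedPost-TFpost (fresh E) ev (toℕ i)) ,
  tr-TF (extend-TF tE λ f i → tr-TF tE (post f i)) φ
  where
  pre-TF : ∀ ev → TF (markedPre (λ f → tr E (pre f)) ev)
  pre-TF zero = (tt , tt)
  pre-TF (suc f) = tr-TF tE (pre f)

AtomsBelow : ℕ → Form nA → Set
AtomsBelow B (atom p) = p < B
AtomsBelow B (¬f φ) = AtomsBelow B φ
AtomsBelow B (φ ∧f ψ) = AtomsBelow B φ × AtomsBelow B ψ
AtomsBelow B (box a φ) = AtomsBelow B φ
AtomsBelow B (star G φ) = AtomsBelow B φ
AtomsBelow B (upd (um k N rel pre post) e φ) =
  (∀ f → AtomsBelow B (pre f)) × (∀ f i → AtomsBelow B (post f i)) × AtomsBelow B φ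

Reads-< : ∀ {L L′} → L ≤ L′ → (φ : Form nA) → Reads (_< L) φ → Reads (_< L′) φ
Reads-< L≤L′ = Reads-mono (λ q<L → <-≤-trans q<L L≤L′)

⇒f-reads : {A : ℕ → Set} (α θ : Form nA) → A 0 → Reads A α → Reads A θ → Reads A (α ⇒f θ)
⇒f-reads α θ A0 rα rθ = (λ { zero → rα ; (suc _) → A0 , A0 }) , (λ _ ()) , Reads-mono inj₂ θ rθ

⋀-reads : {A : ℕ → Set} → ∀ k (F : Fin (suc k) → Form nA) →
          (∀ u → Reads A (F u)) → Reads A (⋀ k F)
⋀-reads zero F r = r zero
⋀-reads (suc k) F r = r zero , ⋀-reads k (F ∘ suc) (r ∘ suc)

truth-reads : {A : ℕ → Set} → A 0 → ∀ b → Reads {nA} A (truth b)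
truth-reads A0 true = A0 , A0
truth-reads A0 false = A0 , A0

markedPost-reads : ∀ {k L} → 0 < L → (ev : Fin (suc (suc k))) → ∀ q →
                   Reads {nA} (_< L) (markedPost L ev q)
markedPost-reads {L = L} 0<L ev q with q <? L
... | yes q<L = q<L
... | no _ = truth-reads {A = _< L} 0<L (freshMark ev (q ∸ L))

valAfter-reads : ∀ {A : ℕ → Set} {N} (post : Fin N → Form nA) (val : ℕ → Form nA) p →
                 (∀ i → Reads A (post i)) → Reads A (val p) → Reads A (valAfter post val p)
valAfter-reads {N = N} post val p r-post r-val with p <? N
... | yes p<N = r-post (fromℕ< p<N)
... | no _ = r-val

record Scoped (B : ℕ) (E : Env nA) : Set where
  field
    fresh-pos  : 0 < fresh E
    real-reads : Reads (_< fresh E) (real E)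
    val-reads  : ∀ {p} → p < B → Reads (_< fresh E) (val E p)
open Scoped

initial-scoped : ∀ {B} → 0 < B → Scoped {nA} B (initial B)
initial-scoped 0<B = record { fresh-pos = 0<B ; real-reads = 0<B , 0<B ; val-reads = λ p<B → p<B }

extend-scoped : ∀ {nA B} {E : Env nA} {k N} {post : Fin (suc k) → Fin N → Form nA} →
                Scoped B E → (∀ f i → Reads (_< fresh E) (post f i)) → Scoped B (extend E k N post)
extend-scoped {nA} {E = E} {k = k} {post = post} sc r-post = record
  { fresh-pos = <-≤-trans (fresh-pos sc) L≤L′
  ; real-reads = Reads-< L≤L′ (real E) (real-reads sc) , m<m+n L (s≤s z≤n)
  ; val-reads = λ {p} p<B → ⋀-reads k _ λ u →
      ⇒f-reads (atom _) (θ u p) (<-≤-trans (fresh-pos sc) L≤L′) (+-monoʳ-< L (s≤s (toℕ<n u)))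
               (Reads-< L≤L′ (θ u p) (valAfter-reads (post u) (val E) p (r-post u) (val-reads sc p<B)))
  }
  where
  L = fresh E
  L≤L′ : L ≤ L + (2 + k)
  L≤L′ = m≤m+n L (2 + k)
  θ : Fin (suc k) → ℕ → Form nA
  θ u = valAfter (post u) (val E)

tr-reads : ∀ {B} {E : Env nA} → Scoped B E → (φ : Form nA) → AtomsBelow B φ →
           Reads (_< fresh E) (tr E φ)
tr-reads sc (atom p) p<B = val-reads sc p<B
tr-reads sc (¬f φ) ab = tr-reads sc φ ab
tr-reads sc (φ ∧f ψ) (ab , ab′) = tr-reads sc φ ab , tr-reads sc ψ ab′
tr-reads {E = E} sc (box a φ) ab =
  ⇒f-reads (real E) (tr E φ) (fresh-pos sc) (real-reads sc) (tr-reads sc φ ab)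
tr-reads {E = E} sc (star G φ) ab =
  ⇒f-reads (real E) (tr E φ) (fresh-pos sc) (real-reads sc) (tr-reads sc φ ab)
tr-reads {E = E} sc (upd (um k N rel pre post) e φ) (ab-pre , ab-post , ab) =
  pre-reads , (λ ev i → markedPost-reads (fresh-pos sc) ev (toℕ i)) ,
  Reads-mono inj₁ (tr E′ φ)
             (tr-reads (extend-scoped sc λ f i → tr-reads sc (post f i) (ab-post f i)) φ ab)
  where
  E′ = extend E k N (λ f i → tr E (post f i))
  pre-reads : ∀ ev → Reads (_< fresh E) (markedPre (λ f → tr E (pre f)) ev)
  pre-reads zero = fresh-pos sc , fresh-pos sc
  pre-reads (suc f) = tr-reads sc (pre f) (ab-pre f)

-- Real x y: y is the real state representing x.  Transitions into copies need not be matched,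
-- hence the guard in back.
record Simulation (B : ℕ) (E : Env nA) (M P : Model nA) : Set₁ where
  field
    Real          : S M → S P → Set
    real-holds    : ∀ {x y} → Real x y → sat P y (real E)
    atom-correct  : ∀ {p x y} → p < B → Real x y → V M p x ⇔ sat P y (val E p)
    forth         : ∀ a → Forth Real (R M a) (R P a)
    back          : ∀ a → Forth (flip Real) (Guarded (R P a) (λ y → sat P y (real E))) (R M a)
    real-backward : ∀ a {y y₁} → R P a y y₁ → sat P y₁ (real E) → sat P y (real E)

  IsReal : S P → Set
  IsReal y = sat P y (real E)

  guard : {RX : S M → S M → Set} {RY : S P → S P → Set} →
          Forth Real RX RY → Forth Real RX (Guarded RY IsReal)
  guard fo rr r = let (y₁ , r′ , rr₁) = fo rr r in y₁ , (r′ , real-holds rr₁) , rr₁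

  back-Star : ∀ {G} → Forth (flip Real) (Guarded (Star (Via G (R P))) IsReal) (Star (Via G (R M)))
  back-Star {G} rr (p , q) =
    Forth-Star back-Via rr (proj₁ (Star-Guarded (λ (a , _ , r) → real-backward a r) p q))
    where
    back-Via : Forth (flip Real) (Guarded (Via G (R P)) IsReal) (Via G (R M))
    back-Via rr ((a , a∈G , r) , q) =
      let (x₁ , r′ , rr₁) = back a rr (r , q) in x₁ , (a , a∈G , r′) , rr₁
open Simulation

identity-simulation : ∀ B (M : Model nA) → Simulation B (initial B) M M
identity-simulation B M = record
  { Real = _≡_
  ; real-holds = λ {_} {y} _ → ⊤f-holds M y
  ; atom-correct = λ { _ refl → ⇔.refl }
  ; forth = λ { a refl r → _ , r , refl }
  ; back = λ { a refl (r , _) → _ , r , refl }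
  ; real-backward = λ a {y} _ _ → ⊤f-holds M y
  }

module _ {B : ℕ} {E : Env nA} {M P : Model nA} (sim : Simulation B E M P) (sc : Scoped B E)
         {k N : ℕ} {rel : Fin nA → Fin (suc k) → Fin (suc k) → Bool}
         {pre preT : Fin (suc k) → Form nA} {post postT : Fin (suc k) → Fin N → Form nA}
         (pre-correct : ∀ f {x y} → Real sim x y → sat M x (pre f) ⇔ sat P y (preT f))
         (post-correct : ∀ f i {x y} → Real sim x y → sat M x (post f i) ⇔ sat P y (postT f i))
         (postT-reads : ∀ f i → Reads (_< fresh E) (postT f i))
         where
  private
    L = fresh E
    E′ = extend E k N postT
    M′ = M ⊗ um k N rel pre post
    open Marked P L k rel preT

    Real′ : S M′ → S P⁺ → Set
    Real′ ((x , f) , _) ((y , ev) , _) = Real sim x y × ev ≡ suc f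

    real-lower : (s : S P⁺) → sat P⁺ s (real E) ⇔ sat P (proj₁ (proj₁ s)) (real E)
    real-lower s = sat-marked {s = s} (real E) (real-reads sc)

    valAfter-correct : ∀ {p} x f h {y} → p < B → Real sim x y →
                       V M′ p ((x , f) , h) ⇔ sat P y (valAfter (postT f) (val E) p)
    valAfter-correct {p} _ f _ p<B rr with p <? N
    ... | yes p<N = post-correct f (fromℕ< p<N) rr
    ... | no _ = atom-correct sim p<B rr

    real-holds′ : ∀ {x y} → Real′ x y → sat P⁺ y (real E′)
    real-holds′ {(_ , f) , _} {s@((y , _) , h)} (rr , refl) =
      from (real-lower s) (real-holds sim rr) , from (real-V y (suc f) h) tt

    atom-correct′ : ∀ {p x y} → p < B → Real′ x y → V M′ p x ⇔ sat P⁺ y (val E′ p)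
    atom-correct′ {p} {(x , f) , h} {s@((y , _) , h′)} p<B (rr , refl) =
      begin
        V M′ p ((x , f) , h) ∼⟨ valAfter-correct x f h p<B rr ⟩
        sat P y (θ f)        ∼⟨ ⇔.sym (sat-marked (θ f) θ-reads) ⟩
        sat P⁺ s (θ f)       ∼⟨ ⇔.sym (sat-select k (λ u → L + suc (toℕ u)) θ (event-V y f h′)) ⟩
        sat P⁺ s (val E′ p)  ∎
      where
      θ : Fin (suc k) → Form nA
      θ u = valAfter (postT u) (val E) p
      θ-reads : Reads (_< L) (θ f)
      θ-reads = valAfter-reads (postT f) (val E) p (postT-reads f) (val-reads sc p<B)

    forth′ : ∀ a → Forth Real′ (R M′ a) (R P⁺ a)
    forth′ a {x₁ = (_ , f₁) , h₁} (rr , refl) (r , t) =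
      let (y₁ , r′ , rr₁) = forth sim a rr r
      in ((y₁ , suc f₁) , to (pre-correct f₁ rr₁) h₁) , (r′ , t) , rr₁ , refl

    back′ : ∀ a → Forth (flip Real′) (Guarded (R P⁺ a) (λ s → sat P⁺ s (real E′))) (R M′ a)
    back′ a {x₁ = (y₁ , zero) , h₁} _ (_ , _ , realMark) = ⊥-elim (to (real-V y₁ zero h₁) realMark)
    back′ a {x₁ = s₁@((_ , suc f₁) , h₁)} (rr , refl) ((r , t) , re , _) =
      let (x₁ , r′ , rr₁) = back sim a rr (r , to (real-lower s₁) re)
      in ((x₁ , f₁) , from (pre-correct f₁ rr₁) h₁) , (r′ , t) , rr₁ , refl

    real-backward′ : ∀ a {s s₁} → R P⁺ a s s₁ → sat P⁺ s₁ (real E′) → sat P⁺ s (real E′)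
    real-backward′ a {s₁ = (y₁ , zero) , h₁} _ (_ , realMark) =
      ⊥-elim (to (real-V y₁ zero h₁) realMark)
    real-backward′ a {(_ , zero) , _} {(_ , suc _) , _} (_ , ()) _
    real-backward′ a {s@((y , suc f) , h)} {s₁@((_ , suc _) , _)} (r , _) (re , _) =
      from (real-lower s) (real-backward sim a r (to (real-lower s₁) re)) , from (real-V y (suc f) h) tt

  extend-simulation : Simulation B E′ M′ P⁺
  extend-simulation = record
    { Real = Real′
    ; real-holds = λ {x} {y} → real-holds′ {x} {y}
    ; atom-correct = λ {p} {x} {y} → atom-correct′ {p} {x} {y}
    ; forth = forth′
    ; back = back′
    ; real-backward = real-backward′
    }

□-⇒f : {P : Model nA} {RY : S P → Set} (α θ : Form nA) →
       (∀ y₁ → RY y₁ × sat P y₁ α → sat P y₁ θ) ⇔ (∀ y₁ → RY y₁ → sat P y₁ (α ⇒f θ))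
□-⇒f α θ = mk⇔ (λ H y₁ r → from (sat-⇒f α θ) λ a → H y₁ (r , a))
               (λ H y₁ (r , a) → to (sat-⇒f α θ) (H y₁ r) a)

tr-correct : ∀ {B} {E : Env nA} {M P : Model nA} (sim : Simulation B E M P) → Scoped B E →
             (φ : Form nA) → AtomsBelow B φ → ∀ {x y} → Real sim x y → sat M x φ ⇔ sat P y (tr E φ)
tr-correct sim sc (atom p) p<B rr = atom-correct sim p<B rr
tr-correct sim sc (¬f φ) ab rr = ¬-cong-⇔ (tr-correct sim sc φ ab rr)
tr-correct sim sc (φ ∧f ψ) (ab , ab′) rr = tr-correct sim sc φ ab rr ×-⇔ tr-correct sim sc ψ ab′ rr
tr-correct {E = E} sim sc (box a φ) ab rr =
  ⇔.trans (□-cong (guard sim (forth sim a)) (back sim a) (tr-correct sim sc φ ab) rr)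
          (□-⇒f (real E) (tr E φ))
tr-correct {E = E} sim sc (star G φ) ab rr =
  ⇔.trans (□-cong (guard sim (Forth-Star (Forth-Via (forth sim)))) (back-Star sim)
                  (tr-correct sim sc φ ab) rr)
          (□-⇒f (real E) (tr E φ))
tr-correct {E = E} {M} {P} sim sc (upd (um k N rel pre post) e φ) (ab-pre , ab-post , ab) rr =
  Π-⇔ (pre-correct e rr) λ _ _ → tr-correct sim′ (extend-scoped sc postT-reads) φ ab (rr , refl)
  where
  pre-correct : ∀ f {x y} → Real sim x y → sat M x (pre f) ⇔ sat P y (tr E (pre f))
  pre-correct f = tr-correct sim sc (pre f) (ab-pre f)
  post-correct : ∀ f i {x y} → Real sim x y → sat M x (post f i) ⇔ sat P y (tr E (post f i))
  post-correct f i = tr-correct sim sc (post f i) (ab-post f i)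
  postT-reads : ∀ f i → Reads (_< fresh E) (tr E (post f i))
  postT-reads f i = tr-reads sc (post f i) (ab-post f i)
  sim′ = extend-simulation sim sc {rel = rel} {pre = pre} {post = post} pre-correct post-correct postT-reads

⨆ : ∀ n → (Fin n → ℕ) → ℕ
⨆ zero _ = 0
⨆ (suc n) g = g zero ⊔ ⨆ n (g ∘ suc)

≤-⨆ : ∀ {n} (g : Fin n → ℕ) i → g i ≤ ⨆ n g
≤-⨆ g zero = m≤m⊔n _ _
≤-⨆ g (suc i) = m≤n⇒m≤o⊔n (g zero) (≤-⨆ (g ∘ suc) i)

maxAtom : Form nA → ℕ
maxAtom (atom p) = p
maxAtom (¬f φ) = maxAtom φ
maxAtom (φ ∧f ψ) = maxAtom φ ⊔ maxAtom ψ
maxAtom (box a φ) = maxAtom φ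
maxAtom (star G φ) = maxAtom φ
maxAtom (upd (um k N rel pre post) e φ) =
  ⨆ (suc k) (λ f → maxAtom (pre f) ⊔ ⨆ N (λ i → maxAtom (post f i))) ⊔ maxAtom φ

AtomsBelow-mono : ∀ {B B′} → B ≤ B′ → (φ : Form nA) → AtomsBelow B φ → AtomsBelow B′ φ
AtomsBelow-mono B≤B′ (atom p) p<B = <-≤-trans p<B B≤B′
AtomsBelow-mono B≤B′ (¬f φ) ab = AtomsBelow-mono B≤B′ φ ab
AtomsBelow-mono B≤B′ (φ ∧f ψ) (ab , ab′) =
  AtomsBelow-mono B≤B′ φ ab , AtomsBelow-mono B≤B′ ψ ab′
AtomsBelow-mono B≤B′ (box a φ) ab = AtomsBelow-mono B≤B′ φ ab
AtomsBelow-mono B≤B′ (star G φ) ab = AtomsBelow-mono B≤B′ φ ab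
AtomsBelow-mono B≤B′ (upd (um k N rel pre post) e φ) (ab-pre , ab-post , ab) =
  (λ f → AtomsBelow-mono B≤B′ (pre f) (ab-pre f)) ,
  (λ f i → AtomsBelow-mono B≤B′ (post f i) (ab-post f i)) ,
  AtomsBelow-mono B≤B′ φ ab

AtomsBelow-maxAtom : (φ : Form nA) → AtomsBelow (suc (maxAtom φ)) φ
AtomsBelow-maxAtom (atom p) = ≤-refl
AtomsBelow-maxAtom (¬f φ) = AtomsBelow-maxAtom φ
AtomsBelow-maxAtom (φ ∧f ψ) =
  AtomsBelow-mono (s≤s (m≤m⊔n _ _)) φ (AtomsBelow-maxAtom φ) ,
  AtomsBelow-mono (s≤s (m≤n⊔m _ _)) ψ (AtomsBelow-maxAtom ψ)
AtomsBelow-maxAtom (box a φ) = AtomsBelow-maxAtom φ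
AtomsBelow-maxAtom (star G φ) = AtomsBelow-maxAtom φ
AtomsBelow-maxAtom (upd (um k N rel pre post) e φ) =
  (λ f → AtomsBelow-mono (s≤s (m≤n⇒m≤n⊔o _ (≤-trans (m≤m⊔n _ _) (≤-⨆ eventBound f))))
                         (pre f) (AtomsBelow-maxAtom (pre f))) ,
  (λ f i → AtomsBelow-mono (s≤s (m≤n⇒m≤n⊔o _ (≤-trans (m≤n⇒m≤o⊔n _ (≤-⨆ _ i)) (≤-⨆ eventBound f))))
                           (post f i) (AtomsBelow-maxAtom (post f i))) ,
  AtomsBelow-mono (s≤s (m≤n⊔m _ _)) φ (AtomsBelow-maxAtom φ)
  where
  eventBound : Fin (suc k) → ℕ
  eventBound f = maxAtom (pre f) ⊔ ⨆ N (λ i → maxAtom (post f i))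

corollary17 : ∀ {nA : ℕ} (φ : Form nA) →
    Σ (Form nA) (λ φTF → TF φTF ×
    ((M : Model nA) (s : S M) → sat M s φ ⇔ sat M s φTF))
corollary17 φ =
  tr (initial B) φ , tr-TF (initial-TF B) φ ,
  λ M s → tr-correct (identity-simulation B M) (initial-scoped (s≤s z≤n)) φ (AtomsBelow-maxAtom φ) refl
  where
  B = suc (maxAtom φ)
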